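{- Let $k\ge 1$ and $d\ge 3$ be integers, and let $T_{k,d}$ be the regular dendrimer tree with $k+1$ levels in which every nonpendent vertex has degree $d$. Then $$TW(T_{k,d})=d(d-1)^{k-1}\Big[kd(d-1)^{k-1}+\frac{1-(d-1)^{k}}{d-2}\Big].$$
   Context: A pendent vertex is a vertex of degree $1$; the terminal Wiener index $TW(T)$ of a tree $T$ is the sum of distances over all unordered pairs of distinct pendent vertices. A regular dendrimer tree $T_{k,d}$ is the rooted tree with $k+1$ levels (root at level $1$) in which the root has $d$ children, every vertex on levels $2,\dots,k$ has $d-1$ children (hence degree $d$), and the vertices on level $k+1$ are pendent. -}

module Defs where

open import Data.Nat using (ℕ; zero; suc; _+_; _∸_; _<_; _≤_)
open import Data.Nat.ListAction using (sum)
open import Data.List using (List; []; _∷_; length; map)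
open import Data.Product using (Σ; _×_; _,_)
open import Data.Sum using (_⊎_)
open import Relation.Binary.PropositionalEquality using (_≡_)

-- Vertices of the regular dendrimer T_{k,d} are addresses: the list of child
-- indices on the path from the root, most recent step first.
-- The root (level 1) has d children; every other non-leaf vertex (levels
-- 2..k) has d-1 children; vertices on level k+1 (length k) have none.
nChildren : ℕ → List ℕ → ℕ
nChildren d []      = d
nChildren d (_ ∷ _) = d ∸ 1

data IsVertex (k d : ℕ) : List ℕ → Set where
  root  : IsVertex k d []
  child : ∀ {a i} → IsVertex k d a → length a < k → i < nChildren d a →
          IsVertex k d (i ∷ a)

Adj : ℕ → ℕ → List ℕ → List ℕ → Set
Adj k d a b = IsVertex k d a × IsVertex k d b ×
              ((Σ ℕ λ i → b ≡ i ∷ a) ⊎ (Σ ℕ λ i → a ≡ i ∷ b))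

Pendent : ℕ → ℕ → List ℕ → Set
Pendent k d a = IsVertex k d a ×
  (Σ (List ℕ) λ b → Adj k d a b × (∀ c → Adj k d a c → c ≡ b))

data Walk (k d : ℕ) : List ℕ → List ℕ → ℕ → Set where
  here : ∀ {a} → IsVertex k d a → Walk k d a a 0
  step : ∀ {a b c n} → Adj k d a b → Walk k d b c n → Walk k d a c (suc n)

IsDistance : ℕ → ℕ → List ℕ → List ℕ → ℕ → Set
IsDistance k d a b n = Walk k d a b n × (∀ m → Walk k d a b m → n ≤ m)

pairSum : {A : Set} → (A → A → ℕ) → List A → ℕ
pairSum f []       = 0
pairSum f (x ∷ xs) = sum (map (f x) xs) + pairSum f xs

module Submission where

-- Two leaves a, b lie at depth k,
-- so their distance is 2k - 2 m(a, b), where m(a, b) is the depth of their meet;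
-- summing over ordered pairs gives TW + Σ m = k N² with N = d (d-1)^(k-1) leaves.
-- Splitting the pairs by their first step from the root gives Σ m = d (E² + V),
-- where E = (d-1)^(k-1) and V is the same sum over the words of length k - 1 on
-- d - 1 letters; the recursion V' = (d-1)(E² + V) yields (d-2) V = E² - E, and
-- eliminating V and Σ m is a ring computation.

open import Data.Nat using (ℕ; zero; suc; _∸_; _^_; _≤_; _<_; z≤n; s≤s; _≟_)
import Data.Nat as ℕ
open import Data.Nat.Properties
open import Data.Nat.ListAction using (sum)
open import Data.Nat.ListAction.Properties using (sum-++; sum-↭)
open import Data.Nat.Tactic.RingSolver using (solve-∀)
open import Data.List using (List; []; _∷_; [_]; _++_; _∷ʳ_; length; map; reverse; downFrom; cartesianProductWith)
open import Data.List.Properties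
  using (map-++; map-∘; length-++; length-map; length-downFrom; ∷-injective;
         unfold-reverse; reverse-++; reverse-involutive; reverse-injective; length-reverse)
open import Data.List.Relation.Unary.All as All using (All)
open import Data.List.Relation.Unary.All.Properties using (∷ʳ⁺; ∷ʳ⁻)
open import Data.List.Relation.Unary.Any using (here; there)
open import Data.List.Relation.Unary.Unique.Propositional using (Unique)
import Data.List.Relation.Unary.Unique.Propositional.Properties as Unique
open import Data.List.Membership.Propositional using (_∈_)
open import Data.List.Membership.Propositional.Properties
  using (∈-map⁺; ∈-map⁻; ∈-downFrom⁺; ∈-downFrom⁻; ∈-cartesianProductWith⁺; ∈-cartesianProductWith⁻)
open import Data.List.Membership.Propositional.Properties.WithK using (unique∧set⇒bag)
open import Data.List.Relation.Binary.BagAndSetEquality using (∼bag⇒↭)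
open import Data.List.Relation.Binary.Permutation.Propositional using (_↭_)
import Data.List.Relation.Binary.Permutation.Propositional.Properties as ↭
open import Data.Product using (Σ; _×_; _,_; proj₁; proj₂)
open import Data.Sum using (inj₁; inj₂)
open import Data.Unit using (⊤; tt)
open import Function using (_∘_)
open import Function.Bundles using (_⇔_; mk⇔; Equivalence)
open import Relation.Binary.PropositionalEquality hiding ([_])
open import Relation.Nullary using (yes; no; contradiction)

open import Defs

module FiniteSums where

  open Data.Nat using (_+_; _*_)
  open import Data.List.Relation.Unary.AllPairs using (_∷_)

  ∑ : {A : Set} → (A → ℕ) → List A → ℕ
  ∑ f xs = sum (map f xs)

  orderedPairSum : {A : Set} → (A → A → ℕ) → List A → ℕ
  orderedPairSum f xs = ∑ (λ x → ∑ (f x) xs) xs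

  module _ {A : Set} where

    ∑-cong : ∀ {f g : A → ℕ} xs → (∀ {x} → x ∈ xs → f x ≡ g x) → ∑ f xs ≡ ∑ g xs
    ∑-cong []       f≗g = refl
    ∑-cong (x ∷ xs) f≗g = cong₂ _+_ (f≗g (here refl)) (∑-cong xs (f≗g ∘ there))

    ∑-+ : ∀ (f g : A → ℕ) xs → ∑ (λ x → f x + g x) xs ≡ ∑ f xs + ∑ g xs
    ∑-+ f g []       = refl
    ∑-+ f g (x ∷ xs) = trans (cong (f x + g x +_) (∑-+ f g xs))
                             (interchange (f x) (g x) (∑ f xs) (∑ g xs))
      where
      interchange : ∀ a b c d → (a + b) + (c + d) ≡ (a + c) + (b + d)
      interchange = solve-∀

    ∑-const : ∀ c (xs : List A) → ∑ (λ _ → c) xs ≡ length xs * c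
    ∑-const c []       = refl
    ∑-const c (x ∷ xs) = cong (c +_) (∑-const c xs)

    ∑-zero : ∀ {f : A → ℕ} xs → (∀ {x} → x ∈ xs → f x ≡ 0) → ∑ f xs ≡ 0
    ∑-zero []       f≡0 = refl
    ∑-zero (x ∷ xs) f≡0 = cong₂ _+_ (f≡0 (here refl)) (∑-zero xs (f≡0 ∘ there))

    ∑-++ : ∀ (f : A → ℕ) xs ys → ∑ f (xs ++ ys) ≡ ∑ f xs + ∑ f ys
    ∑-++ f xs ys = trans (cong sum (map-++ f xs ys)) (sum-++ (map f xs) (map f ys))

    ∑-↭ : ∀ (f : A → ℕ) {xs ys} → xs ↭ ys → ∑ f xs ≡ ∑ f ys
    ∑-↭ f xs↭ys = sum-↭ (↭.map⁺ f xs↭ys)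

    ∑-map : ∀ {B : Set} (f : B → ℕ) (g : A → B) xs → ∑ f (map g xs) ≡ ∑ (f ∘ g) xs
    ∑-map f g xs = cong sum (sym (map-∘ xs))

    ∑-unique-point : ∀ {f : A → ℕ} {i} xs → Unique xs → i ∈ xs →
                     (∀ {j} → j ∈ xs → j ≢ i → f j ≡ 0) → ∑ f xs ≡ f i
    ∑-unique-point {f} (x ∷ xs) (x≢xs ∷ _) (here refl) f≡0 =
      trans (cong (f x +_) (∑-zero xs (λ j∈xs → f≡0 (there j∈xs) (≢-sym (All.lookup x≢xs j∈xs)))))
            (+-identityʳ (f x))
    ∑-unique-point (x ∷ xs) (x≢xs ∷ uxs) (there i∈xs) f≡0 =
      cong₂ _+_ (f≡0 (here refl) (All.lookup x≢xs i∈xs))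
                (∑-unique-point xs uxs i∈xs (f≡0 ∘ there))

  ∑-swap : ∀ {A B : Set} (F : A → B → ℕ) xs ys →
           ∑ (λ x → ∑ (F x) ys) xs ≡ ∑ (λ y → ∑ (λ x → F x y) xs) ys
  ∑-swap F []       ys = sym (∑-zero ys (λ _ → refl))
  ∑-swap F (x ∷ xs) ys = trans (cong (∑ (F x) ys +_) (∑-swap F xs ys))
                               (sym (∑-+ (F x) (λ y → ∑ (λ x → F x y) xs) ys))

  module _ {A : Set} where

    orderedPairSum-cong : ∀ {f g : A → A → ℕ} xs → (∀ {x y} → x ∈ xs → y ∈ xs → f x y ≡ g x y) →
                          orderedPairSum f xs ≡ orderedPairSum g xs
    orderedPairSum-cong xs f≗g = ∑-cong xs (λ x∈xs → ∑-cong xs (f≗g x∈xs))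

    orderedPairSum-+ : ∀ (f g : A → A → ℕ) xs →
      orderedPairSum (λ x y → f x y + g x y) xs ≡ orderedPairSum f xs + orderedPairSum g xs
    orderedPairSum-+ f g xs = trans (∑-cong xs (λ {x} _ → ∑-+ (f x) (g x) xs))
                                    (∑-+ (λ x → ∑ (f x) xs) (λ x → ∑ (g x) xs) xs)

    orderedPairSum-const : ∀ c (xs : List A) →
                           orderedPairSum (λ _ _ → c) xs ≡ length xs * (length xs * c)
    orderedPairSum-const c xs = trans (∑-cong xs (λ _ → ∑-const c xs)) (∑-const _ xs)

    orderedPairSum-↭ : ∀ (f : A → A → ℕ) {xs ys} → xs ↭ ys → orderedPairSum f xs ≡ orderedPairSum f ys
    orderedPairSum-↭ f {xs} {ys} xs↭ys =
      trans (∑-cong xs (λ {x} _ → ∑-↭ (f x) xs↭ys)) (∑-↭ (λ x → ∑ (f x) ys) xs↭ys)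

    orderedPairSum-map : ∀ {B : Set} (f : B → B → ℕ) (g : A → B) xs →
      orderedPairSum f (map g xs) ≡ orderedPairSum (λ x y → f (g x) (g y)) xs
    orderedPairSum-map f g xs =
      trans (∑-map (λ b → ∑ (f b) (map g xs)) g xs) (∑-cong xs (λ {x} _ → ∑-map (f (g x)) g xs))

    2*pairSum+diagonal≡orderedPairSum : ∀ (f : A → A → ℕ) xs →
      (∀ {x y} → x ∈ xs → y ∈ xs → f x y ≡ f y x) →
      2 * pairSum f xs + ∑ (λ x → f x x) xs ≡ orderedPairSum f xs
    2*pairSum+diagonal≡orderedPairSum f []       f-sym = refl
    2*pairSum+diagonal≡orderedPairSum f (x ∷ xs) f-sym = begin
      2 * (row + pairSum f xs) + (f x x + diag)
        ≡⟨ rearrange row (pairSum f xs) (f x x) diag ⟩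
      (f x x + row) + (row + (2 * pairSum f xs + diag))
        ≡⟨ cong₂ (λ c r → (f x x + row) + (c + r)) column
                 (2*pairSum+diagonal≡orderedPairSum f xs (λ p q → f-sym (there p) (there q))) ⟩
      (f x x + row) + (∑ (λ y → f y x) xs + orderedPairSum f xs)
        ≡⟨ cong (f x x + row +_) (sym (∑-+ (λ y → f y x) (λ y → ∑ (f y) xs) xs)) ⟩
      orderedPairSum f (x ∷ xs) ∎
      where
      open ≡-Reasoning
      row  = ∑ (f x) xs
      diag = ∑ (λ y → f y y) xs
      column : row ≡ ∑ (λ y → f y x) xs
      column = ∑-cong xs (λ y∈xs → f-sym (here refl) (there y∈xs))
      rearrange : ∀ r p a t → 2 * (r + p) + (a + t) ≡ (a + r) + (r + (2 * p + t))
      rearrange = solve-∀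

  ∑-cartesianProductWith : ∀ {A B C : Set} (f : A → B → C) (g : C → ℕ) xs ys →
    ∑ g (cartesianProductWith f xs ys) ≡ ∑ (λ x → ∑ (λ y → g (f x y)) ys) xs
  ∑-cartesianProductWith f g []       ys = refl
  ∑-cartesianProductWith f g (x ∷ xs) ys =
    trans (∑-++ g (map (f x) ys) (cartesianProductWith f xs ys))
          (cong₂ _+_ (∑-map g (f x) ys) (∑-cartesianProductWith f g xs ys))

  length-cartesianProductWith : ∀ {A B C : Set} (f : A → B → C) xs ys →
    length (cartesianProductWith f xs ys) ≡ length xs * length ys
  length-cartesianProductWith f []       ys = refl
  length-cartesianProductWith f (x ∷ xs) ys =
    trans (length-++ (map (f x) ys))
          (cong₂ _+_ (length-map (f x) ys) (length-cartesianProductWith f xs ys))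

module Dendrimer where

  open Data.Nat using (_+_; _*_)
  open import Data.List.Relation.Unary.All using ([]; _∷_)
  open import Data.List.Relation.Unary.AllPairs using ([]; _∷_)
  open FiniteSums

  lcp : List ℕ → List ℕ → ℕ
  lcp []       _        = 0
  lcp (_ ∷ _)  []       = 0
  lcp (x ∷ xs) (y ∷ ys) with x ≟ y
  ... | yes _ = suc (lcp xs ys)
  ... | no  _ = 0

  lcp-∷-≡ : ∀ x xs ys → lcp (x ∷ xs) (x ∷ ys) ≡ suc (lcp xs ys)
  lcp-∷-≡ x xs ys with x ≟ x
  ... | yes _   = refl
  ... | no  x≢x = contradiction refl x≢x

  lcp-∷-≢ : ∀ {x y} xs ys → x ≢ y → lcp (x ∷ xs) (y ∷ ys) ≡ 0
  lcp-∷-≢ {x} {y} xs ys x≢y with x ≟ y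
  ... | yes x≡y = contradiction x≡y x≢y
  ... | no  _   = refl

  lcp-refl : ∀ xs → lcp xs xs ≡ length xs
  lcp-refl []       = refl
  lcp-refl (x ∷ xs) = trans (lcp-∷-≡ x xs xs) (cong suc (lcp-refl xs))

  lcp-comm : ∀ xs ys → lcp xs ys ≡ lcp ys xs
  lcp-comm []       []       = refl
  lcp-comm []       (_ ∷ _)  = refl
  lcp-comm (_ ∷ _)  []       = refl
  lcp-comm (x ∷ xs) (y ∷ ys) with x ≟ y
  ... | yes refl = sym (trans (lcp-∷-≡ x ys xs) (cong suc (lcp-comm ys xs)))
  ... | no  x≢y  = sym (lcp-∷-≢ ys xs (≢-sym x≢y))

  lcp≤lcp-∷ʳ : ∀ xs ys i → lcp xs ys ≤ lcp (xs ∷ʳ i) ys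
  lcp≤lcp-∷ʳ []       ys       i = z≤n
  lcp≤lcp-∷ʳ (x ∷ xs) []       i = z≤n
  lcp≤lcp-∷ʳ (x ∷ xs) (y ∷ ys) i with x ≟ y
  ... | yes _ = s≤s (lcp≤lcp-∷ʳ xs ys i)
  ... | no  _ = z≤n

  lcp-∷ʳ≤1+lcp : ∀ xs ys i → lcp (xs ∷ʳ i) ys ≤ suc (lcp xs ys)
  lcp-∷ʳ≤1+lcp []       []       i = z≤n
  lcp-∷ʳ≤1+lcp []       (y ∷ ys) i with i ≟ y
  ... | yes _ = s≤s z≤n
  ... | no  _ = z≤n
  lcp-∷ʳ≤1+lcp (x ∷ xs) []       i = z≤n
  lcp-∷ʳ≤1+lcp (x ∷ xs) (y ∷ ys) i with x ≟ y
  ... | yes _ = s≤s (lcp-∷ʳ≤1+lcp xs ys i)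
  ... | no  _ = z≤n

  lcp-commonPrefix : ∀ xs ys → Σ (List ℕ) λ s → Σ (List ℕ) λ u → Σ (List ℕ) λ v →
                     xs ≡ s ++ u × ys ≡ s ++ v × lcp xs ys ≡ length s
  lcp-commonPrefix []       ys       = [] , [] , ys , refl , refl , refl
  lcp-commonPrefix (x ∷ xs) []       = [] , x ∷ xs , [] , refl , refl , refl
  lcp-commonPrefix (x ∷ xs) (y ∷ ys) with x ≟ y
  ... | no  _    = [] , x ∷ xs , y ∷ ys , refl , refl , refl
  ... | yes refl with lcp-commonPrefix xs ys
  ...   | s , u , v , refl , refl , eq = x ∷ s , u , v , refl , refl , cong suc eq

  -- Addresses list the most recent step first, so the common ancestor of two
  -- vertices is their longest common suffix.
  meetDepth : List ℕ → List ℕ → ℕ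
  meetDepth a b = lcp (reverse a) (reverse b)

  meetDepth-refl : ∀ a → meetDepth a a ≡ length a
  meetDepth-refl a = trans (lcp-refl (reverse a)) (length-reverse a)

  meetDepth-comm : ∀ a b → meetDepth a b ≡ meetDepth b a
  meetDepth-comm a b = lcp-comm (reverse a) (reverse b)

  meetDepth≤meetDepth-∷ : ∀ i a c → meetDepth a c ≤ meetDepth (i ∷ a) c
  meetDepth≤meetDepth-∷ i a c rewrite unfold-reverse i a = lcp≤lcp-∷ʳ (reverse a) (reverse c) i

  meetDepth-∷≤1+meetDepth : ∀ i a c → meetDepth (i ∷ a) c ≤ suc (meetDepth a c)
  meetDepth-∷≤1+meetDepth i a c rewrite unfold-reverse i a = lcp-∷ʳ≤1+lcp (reverse a) (reverse c) i

  2≤nChildren : ∀ {d} → 3 ≤ d → ∀ a → 2 ≤ nChildren d a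
  2≤nChildren 3≤d         []      = ≤-trans (n≤1+n 2) 3≤d
  2≤nChildren (s≤s 2≤d-1) (_ ∷ _) = 2≤d-1

  module _ {k d : ℕ} where

    IsVertex-parent : ∀ {i a} → IsVertex k d (i ∷ a) → IsVertex k d a
    IsVertex-parent (child v _ _) = v

    IsVertex⇒length≤ : ∀ {a} → IsVertex k d a → length a ≤ k
    IsVertex⇒length≤ root            = z≤n
    IsVertex⇒length≤ (child _ a<k _) = a<k

    Adj-sym : ∀ {a b} → Adj k d a b → Adj k d b a
    Adj-sym (va , vb , inj₁ b≡ia) = vb , va , inj₂ b≡ia
    Adj-sym (va , vb , inj₂ a≡ib) = vb , va , inj₁ a≡ib

    Walk-source : ∀ {a b n} → Walk k d a b n → IsVertex k d a
    Walk-source (here va)         = va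
    Walk-source (step (va , _) _) = va

    Walk-++ : ∀ {a b c m n} → Walk k d a b m → Walk k d b c n → Walk k d a c (m + n)
    Walk-++ (here _)   w = w
    Walk-++ (step e u) w = step e (Walk-++ u w)

    Walk-reverse : ∀ {a b n} → Walk k d a b n → Walk k d b a n
    Walk-reverse (here v) = here v
    Walk-reverse {n = suc n} (step e w) =
      subst (Walk k d _ _) (+-comm n 1) (Walk-++ (Walk-reverse w) (step (Adj-sym e) (here (proj₁ e))))

    Walk-toAncestor : ∀ p {a} → IsVertex k d (p ++ a) → Walk k d (p ++ a) a (length p)
    Walk-toAncestor []      v = here v
    Walk-toAncestor (i ∷ p) v =
      step (v , IsVertex-parent v , inj₂ (i , refl)) (Walk-toAncestor p (IsVertex-parent v))

    -- Each step changes the depth by one and the meet depth with the far end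
    -- by at most one in the matching direction.
    length+length≤walk+2*meetDepth : ∀ {a b n} → Walk k d a b n →
                                     length a + length b ≤ n + 2 * meetDepth a b
    length+length≤walk+2*meetDepth {a} (here _) =
      ≤-reflexive (sym (trans (cong (2 *_) (meetDepth-refl a)) (cong (length a +_) (+-identityʳ (length a)))))
    length+length≤walk+2*meetDepth {a} {c} {suc n} (step (_ , _ , inj₁ (i , refl)) w) =
      ≤-pred (begin
        suc (length a + length c)   ≤⟨ length+length≤walk+2*meetDepth w ⟩
        n + 2 * meetDepth (i ∷ a) c ≤⟨ +-monoʳ-≤ n (*-monoʳ-≤ 2 (meetDepth-∷≤1+meetDepth i a c)) ⟩
        n + 2 * suc (meetDepth a c) ≡⟨ shift n (meetDepth a c) ⟩
        suc (suc n + 2 * meetDepth a c) ∎)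
      where
      open ≤-Reasoning
      shift : ∀ n x → n + 2 * suc x ≡ suc (suc n + 2 * x)
      shift = solve-∀
    length+length≤walk+2*meetDepth {_} {c} {suc n} (step {b = b} (_ , _ , inj₂ (i , refl)) w) =
      s≤s (≤-trans (length+length≤walk+2*meetDepth w)
                   (+-monoʳ-≤ n (*-monoʳ-≤ 2 (meetDepth≤meetDepth-∷ i b c))))

    distance+2*meetDepth : ∀ {a b n} → IsDistance k d a b n → n + 2 * meetDepth a b ≡ length a + length b
    distance+2*meetDepth {a} {b} {n} (w , minimal)
      with s , u , v , ra≡su , rb≡sv , lcp≡s ← lcp-commonPrefix (reverse a) (reverse b) =
      ≤-antisym upper (length+length≤walk+2*meetDepth w)
      where
      a≡u++s : a ≡ reverse u ++ reverse s
      a≡u++s = trans (sym (reverse-involutive a)) (trans (cong reverse ra≡su) (reverse-++ s u))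
      b≡v++s : b ≡ reverse v ++ reverse s
      b≡v++s = trans (sym (reverse-involutive b)) (trans (cong reverse rb≡sv) (reverse-++ s v))
      throughMeet : Walk k d a b (length (reverse u) + length (reverse v))
      throughMeet = subst₂ (λ x y → Walk k d x y _) (sym a≡u++s) (sym b≡v++s)
        (Walk-++ (Walk-toAncestor (reverse u) (subst (IsVertex k d) a≡u++s (Walk-source w)))
                 (Walk-reverse (Walk-toAncestor (reverse v)
                    (subst (IsVertex k d) b≡v++s (Walk-source (Walk-reverse w))))))
      length-split : ∀ x y {z} → reverse x ≡ y ++ z → length x ≡ length y + length z
      length-split x y eq = trans (sym (length-reverse x)) (trans (cong length eq) (length-++ y))
      regroup : ∀ s u v → (u + v) + 2 * s ≡ (s + u) + (s + v)
      regroup = solve-∀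
      upper : n + 2 * meetDepth a b ≤ length a + length b
      upper = begin
        n + 2 * meetDepth a b
          ≡⟨ cong (λ z → n + 2 * z) lcp≡s ⟩
        n + 2 * length s
          ≤⟨ +-monoˡ-≤ (2 * length s) (minimal _ throughMeet) ⟩
        (length (reverse u) + length (reverse v)) + 2 * length s
          ≡⟨ cong₂ (λ x y → (x + y) + 2 * length s) (length-reverse u) (length-reverse v) ⟩
        (length u + length v) + 2 * length s
          ≡⟨ regroup (length s) (length u) (length v) ⟩
        (length s + length u) + (length s + length v)
          ≡⟨ sym (cong₂ _+_ (length-split a s ra≡su) (length-split b s rb≡sv)) ⟩
        length a + length b ∎
        where open ≤-Reasoning

    Pendent⇒length≡ : 3 ≤ d → ∀ {a} → Pendent k d a → length a ≡ k
    Pendent⇒length≡ 3≤d {a} (va , b , _ , unique-neighbour) with m≤n⇒m<n∨m≡n (IsVertex⇒length≤ va)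
    ... | inj₂ a≡k = a≡k
    ... | inj₁ a<k = contradiction (trans (neighbour 0 (s≤s z≤n)) (sym (neighbour 1 ≤-refl))) λ ()
      where
      neighbour : ∀ i → i < 2 → i ∷ a ≡ b
      neighbour i i<2 = unique-neighbour (i ∷ a)
        (va , child va a<k (≤-trans i<2 (2≤nChildren 3≤d a)) , inj₁ (i , refl))

    leaf⇒Pendent : 1 ≤ k → ∀ {a} → IsVertex k d a → length a ≡ k → Pendent k d a
    leaf⇒Pendent 1≤k {[]}    _  refl = contradiction 1≤k λ ()
    leaf⇒Pendent 1≤k {i ∷ a} va a≡k  = va , a , (va , IsVertex-parent va , inj₂ (i , refl)) , onlyParent
      where
      onlyParent : ∀ c → Adj k d (i ∷ a) c → c ≡ a
      onlyParent _ (_ , _             , inj₂ (_ , refl)) = refl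
      onlyParent _ (_ , child _ a<k _ , inj₁ (_ , refl)) = contradiction a≡k (<⇒≢ a<k)

  RootFirst : ℕ → List ℕ → Set
  RootFirst d []      = ⊤
  RootFirst d (i ∷ r) = i < d × All (_< d ∸ 1) r

  nChildren-reverse : ∀ d a → nChildren d (reverse a) ≡ nChildren d a
  nChildren-reverse d []      = refl
  nChildren-reverse d (i ∷ a) rewrite unfold-reverse i a = nChildren-∷ʳ (reverse a)
    where
    nChildren-∷ʳ : ∀ r → nChildren d (r ∷ʳ i) ≡ d ∸ 1
    nChildren-∷ʳ []      = refl
    nChildren-∷ʳ (_ ∷ _) = refl

  RootFirst-∷ʳ⁺ : ∀ {d} r {i} → RootFirst d r → i < nChildren d r → RootFirst d (r ∷ʳ i)
  RootFirst-∷ʳ⁺ []      _          i<d = i<d , []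
  RootFirst-∷ʳ⁺ (_ ∷ r) (j<d , rs) i<c = j<d , ∷ʳ⁺ rs i<c

  RootFirst-∷ʳ⁻ : ∀ {d} r {i} → RootFirst d (r ∷ʳ i) → RootFirst d r × i < nChildren d r
  RootFirst-∷ʳ⁻ []      (i<d , [])  = tt , i<d
  RootFirst-∷ʳ⁻ (_ ∷ r) (j<d , ris) = (j<d , proj₁ (∷ʳ⁻ ris)) , proj₂ (∷ʳ⁻ ris)

  module _ {k d : ℕ} where

    IsVertex⇒RootFirst : ∀ {a} → IsVertex k d a → RootFirst d (reverse a)
    IsVertex⇒RootFirst root = tt
    IsVertex⇒RootFirst (child {a} {i} va _ i<c) rewrite unfold-reverse i a =
      RootFirst-∷ʳ⁺ (reverse a) (IsVertex⇒RootFirst va) (subst (i <_) (sym (nChildren-reverse d a)) i<c)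

    RootFirst⇒IsVertex : ∀ a → length a ≤ k → RootFirst d (reverse a) → IsVertex k d a
    RootFirst⇒IsVertex []      _   _  = root
    RootFirst⇒IsVertex (i ∷ a) a<k rf rewrite unfold-reverse i a
      with rfa , i<c ← RootFirst-∷ʳ⁻ (reverse a) rf =
      child (RootFirst⇒IsVertex a (<⇒≤ a<k) rfa) a<k (subst (i <_) (nChildren-reverse d a) i<c)

  words : ℕ → ℕ → List (List ℕ)
  words e zero    = [ [] ]
  words e (suc n) = cartesianProductWith _∷_ (downFrom e) (words e n)

  ∈-words⁺ : ∀ {e} n {r} → length r ≡ n → All (_< e) r → r ∈ words e n
  ∈-words⁺ zero    {[]}    refl []          = here refl
  ∈-words⁺ (suc n) {i ∷ r} eq   (i<e ∷ r<e) =
    ∈-cartesianProductWith⁺ _∷_ (∈-downFrom⁺ i<e) (∈-words⁺ n (suc-injective eq) r<e)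

  ∈-words⁻ : ∀ e n {r} → r ∈ words e n → length r ≡ n × All (_< e) r
  ∈-words⁻ e zero    (here refl) = refl , []
  ∈-words⁻ e (suc n) r∈
    with i , s , i∈ , s∈ , refl ← ∈-cartesianProductWith⁻ _∷_ (downFrom e) (words e n) r∈
    with s≡n , s<e ← ∈-words⁻ e n s∈ = cong suc s≡n , ∈-downFrom⁻ i∈ ∷ s<e

  words-unique : ∀ e n → Unique (words e n)
  words-unique e zero    = [] ∷ []
  words-unique e (suc n) =
    Unique.cartesianProductWith⁺ _∷_ ∷-injective (Unique.downFrom⁺ e) (words-unique e n)

  length-words : ∀ e n → length (words e n) ≡ e ^ n
  length-words e zero    = refl
  length-words e (suc n) =
    trans (length-cartesianProductWith _∷_ (downFrom e) (words e n))
          (cong₂ _*_ (length-downFrom e) (length-words e n))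

  leafAddresses : ℕ → ℕ → List (List ℕ)
  leafAddresses d n = cartesianProductWith _∷_ (downFrom d) (words (d ∸ 1) n)

  ∈-leafAddresses⁺ : ∀ {d} n {r} → length r ≡ suc n → RootFirst d r → r ∈ leafAddresses d n
  ∈-leafAddresses⁺ n {i ∷ r} eq (i<d , r<d-1) =
    ∈-cartesianProductWith⁺ _∷_ (∈-downFrom⁺ i<d) (∈-words⁺ n (suc-injective eq) r<d-1)

  ∈-leafAddresses⁻ : ∀ d n {r} → r ∈ leafAddresses d n → length r ≡ suc n × RootFirst d r
  ∈-leafAddresses⁻ d n r∈
    with i , s , i∈ , s∈ , refl ← ∈-cartesianProductWith⁻ _∷_ (downFrom d) (words (d ∸ 1) n) r∈
    with s≡n , s<d-1 ← ∈-words⁻ (d ∸ 1) n s∈ = cong suc s≡n , ∈-downFrom⁻ i∈ , s<d-1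

  leafAddresses-unique : ∀ d n → Unique (leafAddresses d n)
  leafAddresses-unique d n =
    Unique.cartesianProductWith⁺ _∷_ ∷-injective (Unique.downFrom⁺ d) (words-unique (d ∸ 1) n)

  pendents↭leaves : ∀ {d} n → 3 ≤ d → (L : List (List ℕ)) → Unique L →
                    (∀ a → (a ∈ L) ⇔ Pendent (suc n) d a) →
                    L ↭ map reverse (leafAddresses d n)
  pendents↭leaves {d} n 3≤d L uniqueL L⇔Pendent =
    ∼bag⇒↭ (unique∧set⇒bag uniqueL (Unique.map⁺ reverse-injective (leafAddresses-unique d n))
                           (mk⇔ toLeaves fromLeaves))
    where
    toLeaves : ∀ {a} → a ∈ L → a ∈ map reverse (leafAddresses d n)
    toLeaves {a} a∈L =
      subst (_∈ _) (reverse-involutive a)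
        (∈-map⁺ reverse (∈-leafAddresses⁺ n (trans (length-reverse a) (Pendent⇒length≡ 3≤d pa))
                                            (IsVertex⇒RootFirst (proj₁ pa))))
      where pa = Equivalence.to (L⇔Pendent a) a∈L
    fromLeaves : ∀ {a} → a ∈ map reverse (leafAddresses d n) → a ∈ L
    fromLeaves a∈
      with r , r∈ , refl ← ∈-map⁻ reverse a∈
      with r≡k , rf ← ∈-leafAddresses⁻ d n r∈ =
      Equivalence.from (L⇔Pendent (reverse r))
        (leaf⇒Pendent (s≤s z≤n)
          (RootFirst⇒IsVertex (reverse r) (≤-reflexive a≡k) (subst (RootFirst d) (sym (reverse-involutive r)) rf))
          a≡k)
      where a≡k = trans (length-reverse r) r≡k

  -- lcp (i ∷ r) (j ∷ s) is 1 + lcp r s when i = j and 0 otherwise, so only the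
  -- diagonal blocks i = j contribute.
  orderedPairSum-lcp-prefixed : ∀ I X → Unique I →
    orderedPairSum lcp (cartesianProductWith _∷_ I X)
      ≡ length I * (length X * length X + orderedPairSum lcp X)
  orderedPairSum-lcp-prefixed I X uniqueI = begin
    orderedPairSum lcp C
      ≡⟨ ∑-cong C (λ {x} _ → ∑-cartesianProductWith _∷_ (lcp x) I X) ⟩
    ∑ (λ x → ∑ (λ j → ∑ (λ s → lcp x (j ∷ s)) X) I) C
      ≡⟨ ∑-cartesianProductWith _∷_ (λ x → ∑ (λ j → ∑ (λ s → lcp x (j ∷ s)) X) I) I X ⟩
    ∑ (λ i → ∑ (λ r → ∑ (λ j → ∑ (λ s → lcp (i ∷ r) (j ∷ s)) X) I) X) I
      ≡⟨ ∑-cong I (λ {i} _ → ∑-swap (λ r j → ∑ (λ s → lcp (i ∷ r) (j ∷ s)) X) X I) ⟩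
    ∑ (λ i → ∑ (block i) I) I
      ≡⟨ ∑-cong I (λ i∈I → ∑-unique-point I uniqueI i∈I (λ _ j≢i → block-off-diagonal (≢-sym j≢i))) ⟩
    ∑ (λ i → block i i) I
      ≡⟨ ∑-cong I (λ {i} _ → block-diagonal i) ⟩
    ∑ (λ _ → c) I
      ≡⟨ ∑-const c I ⟩
    length I * c ∎
    where
    open ≡-Reasoning
    C = cartesianProductWith _∷_ I X
    c = length X * length X + orderedPairSum lcp X
    block : ℕ → ℕ → ℕ
    block i j = ∑ (λ r → ∑ (λ s → lcp (i ∷ r) (j ∷ s)) X) X
    block-diagonal : ∀ i → block i i ≡ c
    block-diagonal i = begin
      orderedPairSum (λ r s → lcp (i ∷ r) (i ∷ s)) X
        ≡⟨ orderedPairSum-cong X (λ {r} {s} _ _ → lcp-∷-≡ i r s) ⟩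
      orderedPairSum (λ r s → 1 + lcp r s) X
        ≡⟨ orderedPairSum-+ (λ _ _ → 1) lcp X ⟩
      orderedPairSum (λ _ _ → 1) X + orderedPairSum lcp X
        ≡⟨ cong (_+ orderedPairSum lcp X) (trans (orderedPairSum-const 1 X)
                                                  (cong (length X *_) (*-identityʳ (length X)))) ⟩
      c ∎
    block-off-diagonal : ∀ {i j} → i ≢ j → block i j ≡ 0
    block-off-diagonal {i} {j} i≢j = ∑-zero X (λ {r} _ → ∑-zero X (λ {s} _ → lcp-∷-≢ r s i≢j))

  orderedPairSum-lcp-words-suc : ∀ e n →
    orderedPairSum lcp (words e (suc n)) ≡ e * (e ^ n * e ^ n + orderedPairSum lcp (words e n))
  orderedPairSum-lcp-words-suc e n
    rewrite orderedPairSum-lcp-prefixed (downFrom e) (words e n) (Unique.downFrom⁺ e)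
          | length-downFrom e | length-words e n = refl

  -- The closed form of this sum is where the term (1 - (d-1)^k)/(d-2) comes from.
  orderedPairSum-lcp-words : ∀ c n → let e = suc c in
    c * orderedPairSum lcp (words e n) + e ^ n ≡ e ^ n * e ^ n
  orderedPairSum-lcp-words c zero    = cong (_+ 1) (*-zeroʳ c)
  orderedPairSum-lcp-words c (suc n) = begin
    c * orderedPairSum lcp (words (suc c) (suc n)) + suc c * E
      ≡⟨ cong (λ z → c * z + suc c * E) (orderedPairSum-lcp-words-suc (suc c) n) ⟩
    c * (suc c * (E * E + V)) + suc c * E
      ≡⟨ regroup c E V ⟩
    suc c * (c * (E * E) + (c * V + E))
      ≡⟨ cong (λ z → suc c * (c * (E * E) + z)) (orderedPairSum-lcp-words c n) ⟩
    suc c * (c * (E * E) + E * E)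
      ≡⟨ square c E ⟩
    suc c * E * (suc c * E) ∎
    where
    open ≡-Reasoning
    E = suc c ^ n
    V = orderedPairSum lcp (words (suc c) n)
    regroup : ∀ c E V → c * ((1 + c) * (E * E + V)) + (1 + c) * E ≡ (1 + c) * (c * (E * E) + (c * V + E))
    regroup = solve-∀
    square : ∀ c E → (1 + c) * (c * (E * E) + E * E) ≡ (1 + c) * E * ((1 + c) * E)
    square = solve-∀

  orderedPairSum-meetDepth-leaves : ∀ d n →
    orderedPairSum meetDepth (map reverse (leafAddresses d n))
      ≡ d * ((d ∸ 1) ^ n * (d ∸ 1) ^ n + orderedPairSum lcp (words (d ∸ 1) n))
  orderedPairSum-meetDepth-leaves d n = begin
    orderedPairSum meetDepth (map reverse A)
      ≡⟨ orderedPairSum-map meetDepth reverse A ⟩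
    orderedPairSum (λ r s → meetDepth (reverse r) (reverse s)) A
      ≡⟨ orderedPairSum-cong A (λ {r} {s} _ _ → cong₂ lcp (reverse-involutive r) (reverse-involutive s)) ⟩
    orderedPairSum lcp A
      ≡⟨ orderedPairSum-lcp-prefixed (downFrom d) (words (d ∸ 1) n) (Unique.downFrom⁺ d) ⟩
    length (downFrom d) * (length W * length W + orderedPairSum lcp W)
      ≡⟨ cong₂ (λ x y → x * (y * y + orderedPairSum lcp W)) (length-downFrom d) (length-words (d ∸ 1) n) ⟩
    d * ((d ∸ 1) ^ n * (d ∸ 1) ^ n + orderedPairSum lcp W) ∎
    where
    open ≡-Reasoning
    A = leafAddresses d n
    W = words (d ∸ 1) n

  length-leaves : ∀ d n → length (map reverse (leafAddresses d n)) ≡ d * (d ∸ 1) ^ n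
  length-leaves d n =
    trans (length-map reverse (leafAddresses d n))
          (trans (length-cartesianProductWith _∷_ (downFrom d) (words (d ∸ 1) n))
                 (cong₂ _*_ (length-downFrom d) (length-words (d ∸ 1) n)))

  module _ {k d : ℕ} (δ : List ℕ → List ℕ → ℕ)
           (δ-distance : ∀ a b → IsVertex k d a → IsVertex k d b → IsDistance k d a b (δ a b)) where

    -- For vertices at a common depth n, δ a b = 2n - 2 meetDepth a b; summing over
    -- ordered pairs counts each unordered pair twice and the diagonal contributes 0.
    pairSum+orderedPairSum-meetDepth : ∀ {n} xs → (∀ {a} → a ∈ xs → IsVertex k d a × length a ≡ n) →
      pairSum δ xs + orderedPairSum meetDepth xs ≡ n * (length xs * length xs)
    pairSum+orderedPairSum-meetDepth {n} xs depth≡n = *-cancelˡ-≡ _ _ 2 (begin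
      2 * (P + M)
        ≡⟨ double P M ⟩
      2 * P + 0 + (M + M)
        ≡⟨ cong (λ z → 2 * P + z + (M + M)) (sym (∑-zero xs δ-diagonal)) ⟩
      2 * P + ∑ (λ a → δ a a) xs + (M + M)
        ≡⟨ cong (_+ (M + M)) (2*pairSum+diagonal≡orderedPairSum δ xs δ-sym) ⟩
      orderedPairSum δ xs + (M + M)
        ≡⟨ cong (orderedPairSum δ xs +_) (sym (orderedPairSum-+ meetDepth meetDepth xs)) ⟩
      orderedPairSum δ xs + orderedPairSum (λ a b → meetDepth a b + meetDepth a b) xs
        ≡⟨ sym (orderedPairSum-+ δ (λ a b → meetDepth a b + meetDepth a b) xs) ⟩
      orderedPairSum (λ a b → δ a b + (meetDepth a b + meetDepth a b)) xs
        ≡⟨ orderedPairSum-cong xs (λ {a} {b} a∈ b∈ → trans (cong (δ a b +_) (twice (meetDepth a b))) (distance a∈ b∈)) ⟩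
      orderedPairSum (λ _ _ → n + n) xs
        ≡⟨ orderedPairSum-const (n + n) xs ⟩
      N * (N * (n + n))
        ≡⟨ double′ N n ⟩
      2 * (n * (N * N)) ∎)
      where
      open ≡-Reasoning
      P = pairSum δ xs
      M = orderedPairSum meetDepth xs
      N = length xs
      double : ∀ P M → 2 * (P + M) ≡ 2 * P + 0 + (M + M)
      double = solve-∀
      double′ : ∀ N n → N * (N * (n + n)) ≡ 2 * (n * (N * N))
      double′ = solve-∀
      twice : ∀ m → m + m ≡ 2 * m
      twice m = cong (m +_) (sym (+-identityʳ m))
      distance : ∀ {a b} → a ∈ xs → b ∈ xs → δ a b + 2 * meetDepth a b ≡ n + n
      distance {a} {b} a∈ b∈ with va , a≡n ← depth≡n a∈ | vb , b≡n ← depth≡n b∈ =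
        trans (distance+2*meetDepth (δ-distance a b va vb)) (cong₂ _+_ a≡n b≡n)
      δ-sym : ∀ {a b} → a ∈ xs → b ∈ xs → δ a b ≡ δ b a
      δ-sym {a} {b} a∈ b∈ = +-cancelʳ-≡ (2 * meetDepth a b) (δ a b) (δ b a)
        (trans (distance a∈ b∈)
               (trans (sym (distance b∈ a∈)) (cong (λ z → δ b a + 2 * z) (meetDepth-comm b a))))
      δ-diagonal : ∀ {a} → a ∈ xs → δ a a ≡ 0
      δ-diagonal {a} a∈ = +-cancelʳ-≡ (2 * meetDepth a a) (δ a a) 0
        (trans (distance a∈ a∈)
               (trans (twice n) (sym (cong (2 *_) (trans (meetDepth-refl a) (proj₂ (depth≡n a∈)))))))

open FiniteSums
open Dendrimer

open import Data.Integer using (ℤ; +_; _-_; _*_; _+_)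
open import Data.Integer.Properties using (pos-+; pos-*)
open import Data.Integer.Tactic.RingSolver using (solve)

wienerAlgebra : ∀ (D K P S V E : ℤ) →
  P + S ≡ K * ((D * E) * (D * E)) → S ≡ D * (E * E + V) → (D - + 2) * V + E ≡ E * E →
  (D - + 2) * P ≡ D * E * ((K * D * E) * (D - + 2) + (+ 1 - (D - + 1) * E))
wienerAlgebra D K P S V E P+S S≡ V≡ = begin
  (D - + 2) * P
    ≡⟨ solve (D ∷ P ∷ S ∷ []) ⟩
  (D - + 2) * (P + S) - (D - + 2) * S
    ≡⟨ cong₂ (λ x y → (D - + 2) * x - (D - + 2) * y) P+S S≡ ⟩
  (D - + 2) * (K * (D * E * (D * E))) - (D - + 2) * (D * (E * E + V))
    ≡⟨ solve (D ∷ K ∷ V ∷ E ∷ []) ⟩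
  (D - + 2) * (K * (D * E * (D * E))) - D * ((D - + 2) * (E * E)) - D * ((D - + 2) * V + E) + D * E
    ≡⟨ cong (λ z → (D - + 2) * (K * (D * E * (D * E))) - D * ((D - + 2) * (E * E)) - D * z + D * E) V≡ ⟩
  (D - + 2) * (K * (D * E * (D * E))) - D * ((D - + 2) * (E * E)) - D * (E * E) + D * E
    ≡⟨ solve (D ∷ K ∷ E ∷ []) ⟩
  D * E * ((K * D * E) * (D - + 2) + (+ 1 - (D - + 1) * E)) ∎
  where open ≡-Reasoning

-- With d = 3 + t, the integers + d - + 2 and + d - + 1 reduce to + (1 + t) and + (2 + t).
wienerAlgebraℕ : ∀ t k N P S V E → let d = suc (suc (suc t)) in
  P ℕ.+ S ≡ k ℕ.* (N ℕ.* N) → N ≡ d ℕ.* E → S ≡ d ℕ.* (E ℕ.* E ℕ.+ V) →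
  suc t ℕ.* V ℕ.+ E ≡ E ℕ.* E →
  (+ d - + 2) * + P ≡ + d * + E * ((+ k * + d * + E) * (+ d - + 2) + (+ 1 - + (suc (suc t) ℕ.* E)))
wienerAlgebraℕ t k N P S V E P+S N≡ S≡ V≡ =
  trans (wienerAlgebra (+ d) (+ k) (+ P) (+ S) (+ V) (+ E) P+Sℤ Sℤ Vℤ)
        (cong (λ f → + d * + E * ((+ k * + d * + E) * (+ d - + 2) + (+ 1 - f))) (sym (pos-* (suc (suc t)) E)))
  where
  d = suc (suc (suc t))
  d*E≡ : + (d ℕ.* E) ≡ + d * + E
  d*E≡ = pos-* d E
  E*E≡ : + (E ℕ.* E) ≡ + E * + E
  E*E≡ = pos-* E E
  P+Sℤ : + P + + S ≡ + k * ((+ d * + E) * (+ d * + E))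
  P+Sℤ = begin
    + P + + S
      ≡⟨ sym (pos-+ P S) ⟩
    + (P ℕ.+ S)
      ≡⟨ cong +_ (trans P+S (cong (λ n → k ℕ.* (n ℕ.* n)) N≡)) ⟩
    + (k ℕ.* (d ℕ.* E ℕ.* (d ℕ.* E)))
      ≡⟨ pos-* k (d ℕ.* E ℕ.* (d ℕ.* E)) ⟩
    + k * + (d ℕ.* E ℕ.* (d ℕ.* E))
      ≡⟨ cong (+ k *_) (trans (pos-* (d ℕ.* E) (d ℕ.* E)) (cong₂ _*_ d*E≡ d*E≡)) ⟩
    + k * ((+ d * + E) * (+ d * + E)) ∎
    where open ≡-Reasoning
  Sℤ : + S ≡ + d * (+ E * + E + + V)
  Sℤ = trans (cong +_ S≡)
        (trans (pos-* d (E ℕ.* E ℕ.+ V))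
               (cong (+ d *_) (trans (pos-+ (E ℕ.* E) V) (cong (_+ + V) E*E≡))))
  Vℤ : + (suc t) * + V + + E ≡ + E * + E
  Vℤ = trans (cong (_+ + E) (sym (pos-* (suc t) V)))
        (trans (sym (pos-+ (suc t ℕ.* V) E)) (trans (cong +_ V≡) E*E≡))

corollary3p3 : (k d : ℕ) → 1 ≤ k → 3 ≤ d →
    (L : List (List ℕ)) → Unique L → (∀ a → (a ∈ L) ⇔ Pendent k d a) →
    (δ : List ℕ → List ℕ → ℕ) →
    (∀ a b → IsVertex k d a → IsVertex k d b → IsDistance k d a b (δ a b)) →
    (+ d - + 2) * + (pairSum δ L)
      ≡ + d * + ((d ∸ 1) ^ (k ∸ 1))
          * ((+ k * + d * + ((d ∸ 1) ^ (k ∸ 1))) * (+ d - + 2)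
             + (+ 1 - + ((d ∸ 1) ^ k)))
corollary3p3 (suc n) d@(suc (suc (suc t))) _ 3≤d@(s≤s (s≤s (s≤s _))) L uniqueL L⇔Pendent δ δ-distance =
  wienerAlgebraℕ t (suc n) (length L) (pairSum δ L) S V E P+S N≡ S≡ (orderedPairSum-lcp-words (suc t) n)
  where
  E = (d ∸ 1) ^ n
  S = orderedPairSum meetDepth L
  V = orderedPairSum lcp (words (d ∸ 1) n)
  L↭leaves : L ↭ map reverse (leafAddresses d n)
  L↭leaves = pendents↭leaves n 3≤d L uniqueL L⇔Pendent
  N≡ : length L ≡ d ℕ.* E
  N≡ = trans (↭.↭-length L↭leaves) (length-leaves d n)
  S≡ : S ≡ d ℕ.* (E ℕ.* E ℕ.+ V)
  S≡ = trans (orderedPairSum-↭ meetDepth L↭leaves) (orderedPairSum-meetDepth-leaves d n)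
  P+S : pairSum δ L ℕ.+ S ≡ suc n ℕ.* (length L ℕ.* length L)
  P+S = pairSum+orderedPairSum-meetDepth δ δ-distance L λ a∈L →
    let pendent = Equivalence.to (L⇔Pendent _) a∈L in proj₁ pendent , Pendent⇒length≡ 3≤d pendent
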